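{- For every $k\in\mathbb{N}$ there is a stopwatch automaton $\mathbb{A}_k$ of size $O(\log k)$ such that every (nondeterministic) finite automaton accepting $L(\mathbb{A}_k)$ has size at least $k$.
   Context: A (specific) stopwatch automaton is a tuple $\mathbb{A}=(Q,\Sigma,X,\lambda,\beta,\zeta,\Delta)$ where $Q$ is a finite set of states containing two distinguished states $\mathit{start}$ and $\mathit{accept}$; $\Sigma$ is a finite nonempty alphabet; $X$ is a finite set of stopwatches; $\lambda:Q\to\Sigma$; $\beta:X\to\mathbb{N}$ assigns each stopwatch its bound; $\zeta\subseteq X\times Q$ ($x$ is active in $q$ iff $(x,q)\in\zeta$); $\Delta$ is a finite set of transitions $(q,g,\alpha,q')$ with $g$ a guard and $\alpha$ an action. An assignment is $\xi:X\to\mathbb{N}$ with $\xi(x)\le\beta(x)$. Guards are Boolean circuits taking the binary encoding of an assignment (a block of $\lceil\log(\beta(x)+1)\rceil$ bits per stopwatch) and outputting one bit; actions are Boolean circuits mapping such encodings to encodings of numbers $v_x$, the resulting assignment being $x\mapsto\min\{v_x,\beta(x)\}$. Edges $(q,\xi)\stackrel{t}{\to}(q',\xi')$ between nodes (state, assignment): either $t=0$ and some $(q,g,\alpha,q')\in\Delta$ has $\xi$ satisfying $g$ and $\alpha(\xi)=\xi'$; or $t>0$, $q=q'$, and $\xi'(x)=\min\{\xi(x)+t,\beta(x)\}$ for $x$ active in $q$, $\xi'(x)=\xi(x)$ otherwise. A computation is a sequence $(q_0,\xi_0)\stackrel{t_0}{\to}\cdots\stackrel{t_{\ell-1}}{\to}(q_\ell,\xi_\ell)$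 with $q_i\ne\mathit{accept}$ for $i<\ell$; it is initial if $q_0=\mathit{start}$ and $\xi_0\equiv0$, accepting if $q_\ell=\mathit{accept}$, and reads $\lambda(q_0)^{t_0}\cdots\lambda(q_{\ell-1})^{t_{\ell-1}}$. $L(\mathbb{A})$ is the set of words read by initial accepting computations. The size of a stopwatch automaton is the length of a reasonable binary encoding of it (including its circuits and the binary representations of the bounds). -}

module Defs where

open import Data.Nat using (ℕ; zero; suc; _+_; _*_; _<_; _≤_; _⊓_; _%_; _/_; _≡ᵇ_)
open import Data.Nat.Logarithm using (⌈log₂_⌉)
open import Data.Bool using (Bool; true; false; not; _∧_; _∨_; if_then_else_)
open import Data.Fin using (Fin; zero; suc)
open import Data.Vec using (Vec; []; _∷_; _∷ʳ_; lookup; map; _++_; splitAt; head)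
open import Data.List using (List; []; _∷_; replicate) renaming (_++_ to _++ˡ_; map to mapˡ)
open import Data.Nat.ListAction using () renaming (sum to sumˡ)
open import Data.Product using (Σ; _×_; _,_; proj₁; proj₂)
open import Data.List.Membership.Propositional using (_∈_)
open import Relation.Binary.PropositionalEquality using (_≡_; _≢_)

data Gate (k : ℕ) : Set where
  constG : Bool → Gate k
  notG   : Fin k → Gate k
  andG   : Fin k → Fin k → Gate k
  orG    : Fin k → Fin k → Gate k

-- Gates n k : a sequence of gates on n input wires producing k wires in total
-- (the n inputs followed by one wire per gate, in order).
data Gates (n : ℕ) : ℕ → Set where
  inputs : Gates n n
  _▷_    : ∀ {k} → Gates n k → Gate k → Gates n (suc k)

gateCount : ∀ {n k} → Gates n k → ℕ
gateCount inputs   = 0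
gateCount (gs ▷ _) = suc (gateCount gs)

evalGate : ∀ {k} → Gate k → Vec Bool k → Bool
evalGate (constG b) v = b
evalGate (notG i)   v = not (lookup v i)
evalGate (andG i j) v = lookup v i ∧ lookup v j
evalGate (orG i j)  v = lookup v i ∨ lookup v j

wires : ∀ {n k} → Gates n k → Vec Bool n → Vec Bool k
wires inputs   x = x
wires (gs ▷ g) x = let v = wires gs x in v ∷ʳ evalGate g v

record Circuit (n m : ℕ) : Set where
  field
    nWires  : ℕ
    gates   : Gates n nWires
    outputs : Vec (Fin nWires) m

evalCircuit : ∀ {n m} → Circuit n m → Vec Bool n → Vec Bool m
evalCircuit c x = map (lookup (wires (Circuit.gates c) x)) (Circuit.outputs c)

circuitSize : ∀ {n m} → Circuit n m → ℕ
circuitSize {m = m} c = gateCount (Circuit.gates c) + m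

width : ℕ → ℕ
width b = ⌈log₂ (suc b) ⌉

toBits : (w : ℕ) → ℕ → Vec Bool w
toBits zero    n = []
toBits (suc w) n = (n % 2 ≡ᵇ 1) ∷ toBits w (n / 2)

fromBits : ∀ {w} → Vec Bool w → ℕ
fromBits []       = 0
fromBits (b ∷ bs) = (if b then 1 else 0) + 2 * fromBits bs

totalWidth : (nX : ℕ) → (Fin nX → ℕ) → ℕ
totalWidth zero    β = 0
totalWidth (suc n) β = width (β zero) + totalWidth n (λ x → β (suc x))

encode : (nX : ℕ) (β : Fin nX → ℕ) → (Fin nX → ℕ) → Vec Bool (totalWidth nX β)
encode zero    β ξ = []
encode (suc n) β ξ = toBits (width (β zero)) (ξ zero) ++ encode n (λ x → β (suc x)) (λ x → ξ (suc x))

decode : (nX : ℕ) (β : Fin nX → ℕ) → Vec Bool (totalWidth nX β) → Fin nX → ℕ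
decode zero    β v ()
decode (suc n) β v x with splitAt (width (β zero)) v
decode (suc n) β v zero    | (u , w , _) = fromBits u
decode (suc n) β v (suc x) | (u , w , _) = decode n (λ y → β (suc y)) w x

record Transition (nQ W : ℕ) : Set where
  field
    source : Fin nQ
    guard  : Circuit W 1
    action : Circuit W W
    target : Fin nQ

record SWA (nΣ : ℕ) : Set where
  field
    nQ     : ℕ
    nX     : ℕ
    start  : Fin nQ
    accept : Fin nQ
    lab    : Fin nQ → Fin nΣ
    bound  : Fin nX → ℕ
    active : Fin nX → Fin nQ → Bool
    trans  : List (Transition nQ (totalWidth nX bound))

  W : ℕ
  W = totalWidth nX bound

  Assignment : Set
  Assignment = Fin nX → ℕ

  Sat : Circuit W 1 → Assignment → Set
  Sat g ξ = head (evalCircuit g (encode nX bound ξ)) ≡ true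

  act : Circuit W W → Assignment → Assignment
  act α ξ x = decode nX bound (evalCircuit α (encode nX bound ξ)) x ⊓ bound x

  elapse : Fin nQ → ℕ → Assignment → Assignment
  elapse q t ξ x = if active x q then (ξ x + t) ⊓ bound x else ξ x

  -- Accepts q ξ w : there is an (accepting) computation from (q, ξ) reading w,
  -- passing through non-accept states except at its last node.
  data Accepts : Fin nQ → Assignment → List (Fin nΣ) → Set where
    done  : ∀ {ξ} → Accepts accept ξ []
    jump  : ∀ {q ξ w} (δ : Transition nQ W) → q ≢ accept → δ ∈ trans →
            Transition.source δ ≡ q → Sat (Transition.guard δ) ξ →
            Accepts (Transition.target δ) (act (Transition.action δ) ξ) w →
            Accepts q ξ w
    delay : ∀ {q ξ w} (t : ℕ) → q ≢ accept → 0 < t →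
            Accepts q (elapse q t ξ) w →
            Accepts q ξ (replicate t (lab q) ++ˡ w)

  Lang : List (Fin nΣ) → Set
  Lang w = Accepts start (λ _ → 0) w

  -- size of the (binary) encoding: components counted as units, bounds in binary,
  -- circuits by their size
  size : ℕ
  size = nQ + nΣ + nX + 2 + nQ + nX * nQ
         + totalWidth nX bound
         + sumˡ (mapˡ (λ δ → 2 + circuitSize (Transition.guard δ)
                                + circuitSize (Transition.action δ)) trans)

record NFA (nΣ : ℕ) : Set where
  field
    nStates : ℕ
    initial : Fin nStates → Bool
    final   : Fin nStates → Bool
    δ       : Fin nStates → Fin nΣ → Fin nStates → Bool

  data AcceptsFrom : Fin nStates → List (Fin nΣ) → Set where
    nil  : ∀ {p} → final p ≡ true → AcceptsFrom p []
    cons : ∀ {p a p' w} → δ p a p' ≡ true → AcceptsFrom p' w → AcceptsFrom p (a ∷ w)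

  Lang : List (Fin nΣ) → Set
  Lang w = Σ (Fin nStates) λ p → initial p ≡ true × AcceptsFrom p w

{-# OPTIONS --safe #-}
-- Over a one-letter alphabet let A_m have a single stopwatch with bound 2^(m+1), so that its
-- encoding has a bit m, and a single transition, into accept, guarded by that bit.  Bit m can
-- only be set once the stopwatch reads at least 2^m, so A_m accepts a^(2^m) but no shorter word,
-- while its size is linear in the bit width m.  An NFA accepting a^K with at most K states
-- repeats a state along the run; cutting out the loop yields an accepted shorter word, so an NFA
-- for L(A_m) needs more than 2^m states.  Taking m = ⌊log₂ k⌋ + 1 gives 2^m > k.
module Submission where

open import Defs
open import Data.Nat using (ℕ; _+_; _*_; _≤_)
open import Data.Nat.Logarithm using (⌊log₂_⌋)
open import Data.Fin using (Fin)
open import Data.List using (List)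
open import Data.Product using (Σ; _×_)
open import Function.Bundles using (_⇔_)

open import Data.Nat using (zero; suc; _<_; _∸_; _^_; _⊓_; _/_; _≤?_; z≤n; s≤s; NonZero)
open import Data.Nat.Properties
open import Data.Nat.DivMod using (m*n/n≡m; m/n*n≤m)
open import Data.Nat.Logarithm using (⌊log₂⌋-mono-≤; ⌊log₂[2^n]⌋≡n; ⌈log₂⌉-mono-≤; ⌈log₂2^n⌉≡n)
open import Data.Nat.Tactic.RingSolver using (solve)
open import Data.Fin as F using (toℕ; fromℕ<; _↑ˡ_)
open import Data.Fin.Properties using (toℕ-fromℕ<; toℕ≤pred[n]; pigeonhole)
open import Data.Vec as V using ([]; _∷_; lookup; allFin)
open import Data.Vec.Properties using (lookup-++ˡ)
open import Data.List as L using ([]; _∷_; replicate; length) renaming (_++_ to _++ˡ_)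
open import Data.List.Properties using (length-++; length-replicate; ++-identityʳ)
open import Data.List.Relation.Unary.Any using (here; there)
open import Data.Product using (_,_; proj₁)
open import Data.Bool using (true)
open import Function.Bundles using (Equivalence)
open import Function.Base using (_∘′_)
open import Relation.Binary.PropositionalEquality using (_≡_; refl; sym; trans; cong; subst)
open import Relation.Nullary using (yes; no; contradiction)

n<2^suc⌊log₂n⌋ : ∀ n → n < 2 ^ suc ⌊log₂ n ⌋
n<2^suc⌊log₂n⌋ n = ≰⇒> λ 2^≤n →
  1+n≰n (subst (_≤ ⌊log₂ n ⌋) (⌊log₂[2^n]⌋≡n (suc ⌊log₂ n ⌋)) (⌊log₂⌋-mono-≤ 2^≤n))

n≤width[2^n] : ∀ n → n ≤ width (2 ^ n)
n≤width[2^n] n = subst (_≤ width (2 ^ n)) (⌈log₂2^n⌉≡n n) (⌈log₂⌉-mono-≤ (n≤1+n (2 ^ n)))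

width[2^n]≤1+n : ∀ n → width (2 ^ n) ≤ suc n
width[2^n]≤1+n n = subst (width (2 ^ n) ≤_) (⌈log₂2^n⌉≡n (suc n))
  (⌈log₂⌉-mono-≤ 1+2^n≤2*2^n)
  where
    1+2^n≤2*2^n : suc (2 ^ n) ≤ 2 * 2 ^ n
    1+2^n≤2*2^n = ≤-trans (≤-reflexive (+-comm 1 (2 ^ n)))
                          (+-monoʳ-≤ (2 ^ n) (≤-trans (m^n>0 2 n) (m≤m+n (2 ^ n) 0)))

lookup-toBits⇒2^≤ : ∀ w x (i : Fin w) → lookup (toBits w x) i ≡ true → 2 ^ toℕ i ≤ x
lookup-toBits⇒2^≤ (suc w) zero    F.zero ()
lookup-toBits⇒2^≤ (suc w) (suc x) F.zero _ = s≤s z≤n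
lookup-toBits⇒2^≤ (suc w) x (F.suc i) bit = begin
  2 * 2 ^ toℕ i ≤⟨ *-monoʳ-≤ 2 (lookup-toBits⇒2^≤ w (x / 2) i bit) ⟩
  2 * (x / 2)   ≡⟨ *-comm 2 (x / 2) ⟩
  x / 2 * 2     ≤⟨ m/n*n≤m x 2 ⟩
  x             ∎
  where open ≤-Reasoning

lookup-toBits-2^ : ∀ w (i : Fin w) → lookup (toBits w (2 ^ toℕ i)) i ≡ true
lookup-toBits-2^ (suc w) F.zero    = refl
lookup-toBits-2^ (suc w) (F.suc i) =
  subst (λ v → lookup (toBits w v) i ≡ true) (sym 2^[1+j]/2≡2^j) (lookup-toBits-2^ w i)
  where
    2^[1+j]/2≡2^j : 2 ^ suc (toℕ i) / 2 ≡ 2 ^ toℕ i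
    2^[1+j]/2≡2^j = trans (cong (_/ 2) (*-comm 2 (2 ^ toℕ i))) (m*n/n≡m (2 ^ toℕ i) 2)

module UnaryNFA {nΣ : ℕ} (N : NFA nΣ) (a : Fin nΣ) where
  open NFA N

  data Path : Fin nStates → Fin nStates → ℕ → Set where
    stop : ∀ {p} → Path p p 0
    step : ∀ {p p′ q n} → δ p a p′ ≡ true → Path p′ q n → Path p q (suc n)

  split-replicate : ∀ i r {p} → AcceptsFrom p (replicate (i + r) a) →
                    Σ (Fin nStates) λ q → Path p q i × AcceptsFrom q (replicate r a)
  split-replicate zero    r acc          = _ , stop , acc
  split-replicate (suc i) r (cons d acc) with split-replicate i r acc
  ... | q , path , acc′ = q , step d path , acc′

  join-replicate : ∀ {p q i r} → Path p q i → AcceptsFrom q (replicate r a) →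
                   AcceptsFrom p (replicate (i + r) a)
  join-replicate stop          acc = acc
  join-replicate (step d path) acc = cons d (join-replicate path acc)

  -- Pumping down: the K + 1 states visited while reading a^K cannot all be distinct.
  shorten : ∀ K {p} → nStates ≤ K → AcceptsFrom p (replicate K a) →
            Σ ℕ λ n → n < K × AcceptsFrom p (replicate n a)
  shorten K {p} nStates≤K acc = cutLoop (pigeonhole (s≤s nStates≤K) (λ i → proj₁ (splitAt i)))
    where
      splitAt : (i : Fin (suc K)) → Σ (Fin nStates) λ q →
                Path p q (toℕ i) × AcceptsFrom q (replicate (K ∸ toℕ i) a)
      splitAt i = split-replicate (toℕ i) (K ∸ toℕ i)
        (subst (λ n → AcceptsFrom p (replicate n a)) (sym (m+[n∸m]≡n (toℕ≤pred[n] i))) acc)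

      cutLoop : (Σ (Fin (suc K)) λ i → Σ (Fin (suc K)) λ j → i F.< j × proj₁ (splitAt i) ≡ proj₁ (splitAt j)) →
                Σ ℕ λ n → n < K × AcceptsFrom p (replicate n a)
      cutLoop (i , j , i<j , same) with splitAt i | splitAt j
      ... | _ , pathᵢ , _ | _ , _ , accⱼ =
        toℕ i + (K ∸ toℕ j) ,
        subst (toℕ i + (K ∸ toℕ j) <_) (m+[n∸m]≡n (toℕ≤pred[n] j)) (+-monoˡ-< (K ∸ toℕ j) i<j) ,
        join-replicate pathᵢ (subst (λ q → AcceptsFrom q (replicate (K ∸ toℕ j) a)) (sym same) accⱼ)

  minimalLength<nStates : ∀ K → (∀ w → Lang w → K ≤ length w) → Lang (replicate K a) → K < nStates
  minimalLength<nStates K long (p , initial-p , acc) with nStates ≤? K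
  ... | no nStates≰K = ≰⇒> nStates≰K
  ... | yes nStates≤K with shorten K nStates≤K acc
  ...   | n , n<K , acc′ =
    contradiction (subst (K ≤_) (length-replicate n) (long _ (p , initial-p , acc′))) (<⇒≱ n<K)

module BitGuard (m : ℕ) where
  bound : ℕ
  bound = 2 ^ suc m

  K : ℕ
  K = 2 ^ m

  bit : Fin (width bound)
  bit = fromℕ< (n≤width[2^n] (suc m))

  guard : Circuit (width bound + 0) 1
  guard = record { nWires = width bound + 0 ; gates = inputs ; outputs = (bit ↑ˡ 0) ∷ [] }

  identity : Circuit (width bound + 0) (width bound + 0)
  identity = record { nWires = width bound + 0 ; gates = inputs ; outputs = allFin _ }

  fire : Transition 2 (width bound + 0)
  fire = record { source = F.zero ; guard = guard ; action = identity ; target = F.suc F.zero }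

  A : SWA 1
  A = record
    { nQ = 2 ; nX = 1 ; start = F.zero ; accept = F.suc F.zero
    ; lab = λ _ → F.zero ; bound = λ _ → bound ; active = λ _ _ → true
    ; trans = fire ∷ [] }

  open SWA A using (Accepts; Lang; Sat; done; jump; delay)

  toℕ-bit : toℕ bit ≡ m
  toℕ-bit = toℕ-fromℕ< (n≤width[2^n] (suc m))

  sat⇒K≤ : ∀ ξ → Sat guard ξ → K ≤ ξ F.zero
  sat⇒K≤ ξ sat = subst (λ e → 2 ^ e ≤ ξ F.zero) toℕ-bit
    (lookup-toBits⇒2^≤ (width bound) (ξ F.zero) bit
      (trans (sym (lookup-++ˡ (toBits (width bound) (ξ F.zero)) [] bit)) sat))

  sat-K : ∀ ξ → ξ F.zero ≡ K → Sat guard ξ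
  sat-K ξ ξ₀≡K =
    subst (λ v → lookup (toBits (width bound) v V.++ []) (bit ↑ˡ 0) ≡ true) (sym ξ₀≡K)
      (trans (lookup-++ˡ (toBits (width bound) K) [] bit)
        (subst (λ e → lookup (toBits (width bound) (2 ^ e)) bit ≡ true) toℕ-bit
          (lookup-toBits-2^ (width bound) bit)))

  accepts⇒K≤ : ∀ {q ξ w} → Accepts q ξ w → q ≡ F.zero → K ≤ ξ F.zero + length w
  accepts⇒K≤ done ()
  accepts⇒K≤ {ξ = ξ} {w} (jump _ _ (here refl) _ sat _) _ = ≤-trans (sat⇒K≤ ξ sat) (m≤m+n _ (length w))
  accepts⇒K≤ (jump _ _ (there ()) _ _ _) _
  accepts⇒K≤ {ξ = ξ} (delay {w = w} t _ _ rest) refl = begin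
    K                                            ≤⟨ accepts⇒K≤ rest refl ⟩
    (ξ F.zero + t) ⊓ bound + length w            ≤⟨ +-monoˡ-≤ (length w) (m⊓n≤m (ξ F.zero + t) bound) ⟩
    ξ F.zero + t + length w                      ≡⟨ +-assoc (ξ F.zero) t (length w) ⟩
    ξ F.zero + (t + length w)                    ≡⟨ cong (ξ F.zero +_) (sym length-tw) ⟩
    ξ F.zero + length (replicate t F.zero ++ˡ w) ∎
    where
      open ≤-Reasoning
      length-tw : length (replicate t F.zero ++ˡ w) ≡ t + length w
      length-tw = trans (length-++ (replicate t F.zero)) (cong (_+ length w) (length-replicate t))

  Lang⇒K≤length : ∀ w → Lang w → K ≤ length w
  Lang⇒K≤length w acc = accepts⇒K≤ acc refl

  Lang-a^K : Lang (replicate K F.zero)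
  Lang-a^K = subst (Accepts F.zero (λ _ → 0)) (++-identityʳ _)
    (delay K (λ ()) (m^n>0 2 m)
      (jump fire (λ ()) (here refl) refl (sat-K ξ (m≤n⇒m⊓n≡m (m≤m+n K _))) done))
    where
      ξ : SWA.Assignment A
      ξ = SWA.elapse A F.zero K (λ _ → 0)

  size-A : SWA.size A ≤ 17 + 2 * m
  size-A = begin
    SWA.size A                        ≡⟨⟩
    10 + W + (3 + W + 0)              ≤⟨ +-mono-≤ (+-monoʳ-≤ 10 W≤2+m) (+-monoˡ-≤ 0 (+-monoʳ-≤ 3 W≤2+m)) ⟩
    10 + (2 + m) + (3 + (2 + m) + 0)  ≡⟨ solve (m L.∷ L.[]) ⟩
    17 + 2 * m                        ∎
    where
      open ≤-Reasoning
      W : ℕ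
      W = width bound + 0
      W≤2+m : W ≤ 2 + m
      W≤2+m = subst (_≤ 2 + m) (sym (+-identityʳ (width bound))) (width[2^n]≤1+n (suc m))

17+2*n≤19*n : ∀ n .{{_ : NonZero n}} → 17 + 2 * n ≤ 19 * n
17+2*n≤19*n n = ≤-trans (+-monoˡ-≤ (2 * n) (m≤m*n 17 n)) (≤-reflexive (sym (*-distribʳ-+ n 17 2)))

mainTheorem4 : Σ ℕ λ c → (k : ℕ) →
    Σ ℕ λ nΣ → Σ (SWA (1 + nΣ)) λ A →
      (SWA.size A ≤ c * (1 + ⌊log₂ k ⌋))
      × ((N : NFA (1 + nΣ)) → ((w : List (Fin (1 + nΣ))) → NFA.Lang N w ⇔ SWA.Lang A w)
           → k ≤ NFA.nStates N)
mainTheorem4 = 19 , λ k → 0 , BitGuard.A (suc ⌊log₂ k ⌋) , size-bound k , lower-bound k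
  where
    size-bound : ∀ k → SWA.size (BitGuard.A (suc ⌊log₂ k ⌋)) ≤ 19 * (1 + ⌊log₂ k ⌋)
    size-bound k = ≤-trans (BitGuard.size-A (suc ⌊log₂ k ⌋)) (17+2*n≤19*n (suc ⌊log₂ k ⌋))

    lower-bound : ∀ k (N : NFA 1) →
                  ((w : List (Fin 1)) → NFA.Lang N w ⇔ SWA.Lang (BitGuard.A (suc ⌊log₂ k ⌋)) w) →
                  k ≤ NFA.nStates N
    lower-bound k N L[N]≡L[A] = <⇒≤ (<-trans (n<2^suc⌊log₂n⌋ k)
      (minimalLength<nStates K (λ w → Lang⇒K≤length w ∘′ to (L[N]≡L[A] w)) (from (L[N]≡L[A] _) Lang-a^K)))
      where
        open BitGuard (suc ⌊log₂ k ⌋)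
        open UnaryNFA N F.zero
        open Equivalence
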